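{- There is no connected graph $G$ with $n$ vertices and minimum degree $\delta$ such that $\pi^*(G)=\frac{4n}{\delta+1}$.
   Context: All graphs are finite and simple. A pebbling distribution $D$ on a graph $G$ is a function $D:V(G)\to\mathbb{Z}_{\ge 0}$; its size is $|D|=\sum_v D(v)$. A pebbling move removes two pebbles from a vertex having at least two pebbles and places one pebble on an adjacent vertex. A vertex $v$ is reachable under $D$ if some sequence of legal pebbling moves puts at least one pebble on $v$. $D$ is solvable if every vertex is reachable. The optimal pebbling number $\pi^*(G)$ is the minimum size of a solvable distribution on $G$. -}

module Defs where

open import Data.Nat using (ℕ; _+_; _∸_; _≤_)
open import Data.Bool using (Bool; true; false; if_then_else_)
open import Data.Fin using (Fin; _≟_)
open import Data.List using (List; map; allFin)
open import Data.Nat.ListAction using (sum)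
open import Data.Product using (Σ; ∃; _×_)
open import Relation.Nullary using (does)
open import Relation.Binary.PropositionalEquality using (_≡_)
open import Relation.Binary.Construct.Closure.ReflexiveTransitive using (Star)

record Graph (n : ℕ) : Set where
  field
    adj    : Fin n → Fin n → Bool
    sym    : ∀ u v → adj u v ≡ adj v u
    irrefl : ∀ v → adj v v ≡ false
open Graph public

Adjacent : ∀ {n} → Graph n → Fin n → Fin n → Set
Adjacent G u v = adj G u v ≡ true

Connected : ∀ {n} → Graph n → Set
Connected {n} G = ∀ (u v : Fin n) → Star (Adjacent G) u v

degree : ∀ {n} → Graph n → Fin n → ℕ
degree {n} G v = sum (map (λ w → if adj G v w then 1 else 0) (allFin n))

MinDegree : ∀ {n} → Graph n → ℕ → Set
MinDegree {n} G δ = (∀ v → δ ≤ degree G v) × ∃ λ v → degree G v ≡ δ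

Distribution : ℕ → Set
Distribution n = Fin n → ℕ

size : ∀ {n} → Distribution n → ℕ
size {n} D = sum (map D (allFin n))

Move : ∀ {n} → Graph n → Distribution n → Distribution n → Set
Move {n} G D D' = Σ (Fin n) λ u → Σ (Fin n) λ v →
  Adjacent G u v × 2 ≤ D u ×
  (∀ w → D' w ≡ (D w ∸ (if does (w ≟ u) then 2 else 0)) + (if does (w ≟ v) then 1 else 0))

Reachable : ∀ {n} → Graph n → Distribution n → Fin n → Set
Reachable G D v = ∃ λ D' → Star (Move G) D D' × 1 ≤ D' v

Solvable : ∀ {n} → Graph n → Distribution n → Set
Solvable G D = ∀ v → Reachable G D v

IsOptimalPebblingNumber : ∀ {n} → Graph n → ℕ → Set
IsOptimalPebblingNumber G k =
  (∃ λ D → Solvable G D × size D ≡ k) × (∀ D → Solvable G D → k ≤ size D)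

module Submission where

-- No connected graph G with n vertices and minimum degree δ has π*(G) = 4n/(δ+1);
-- in fact π*(G)·(δ+1) < 4n.
--
-- Let S be a maximal set of vertices at pairwise distance at least three, found
-- greedily.  The closed neighbourhoods N[s], s ∈ S, are disjoint and have at least
-- δ+1 vertices each, so |S|·(δ+1) ≤ n; every vertex is within distance two of S,
-- so four pebbles on each s ∈ S form a solvable distribution of size 4|S|.
--   * If some vertex lies in no N[s], then |S|·(δ+1) < n and this distribution wins.
--   * Otherwise every vertex v has a unique centre s ∈ S with v ∈ N[s].  If all
--     centres agree, two pebbles on that centre suffice.  If not, connectivity gives
--     an edge ab whose endpoints have different centres c₁, c₂; then c₁ a b c₂ is a
--     path, and trading the eight pebbles on c₁, c₂ for two on a and four on b keeps
--     the distribution solvable with only 4|S| − 2 pebbles.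

open import Defs
open import Data.Nat using (ℕ; zero; suc; _+_; _*_; _∸_; _≤_; _<_; z≤n; s≤s)
open import Data.Nat.Properties hiding (_≟_)
open import Data.Nat.ListAction using (sum)
open import Data.Bool using (true; false; if_then_else_)
import Data.Bool.Properties as Bool
open import Data.Fin using (Fin; zero; suc; _≟_)
open import Data.Fin.Properties using (any?; all?; ¬∀⟶∃¬)
open import Data.List using (List; []; _∷_; map; length; allFin; tabulate)
open import Data.List.Properties using (map-cong)
open import Data.List.Relation.Unary.All as All using (All; []; _∷_)
open import Data.List.Relation.Unary.All.Properties using (¬Any⇒All¬)
open import Data.List.Relation.Unary.Any as Any using (Any; here; there)
open import Data.List.Relation.Unary.AllPairs using (AllPairs; []; _∷_)
open import Data.List.Membership.Propositional using (_∈_; find)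
open import Data.List.Membership.Propositional.Properties using (∈-allFin)
open import Data.Product using (Σ; ∃; ∃₂; _×_; _,_; proj₁; proj₂)
open import Data.Sum using (_⊎_; inj₁; inj₂)
open import Data.Empty using (⊥-elim)
open import Function using (_∘_; id)
open import Relation.Nullary using (yes; no; does; ¬_)
open import Relation.Nullary.Decidable using (_⊎-dec_; _×-dec_; dec-true; dec-false)
open import Relation.Binary using (Decidable; DecidableEquality; Symmetric; Reflexive)
open import Relation.Binary.PropositionalEquality as ≡ hiding (sym)
open import Relation.Binary.Construct.Closure.ReflexiveTransitive using (Star; ε; _◅_; _◅◅_)
open import Algebra.Properties.CommutativeMonoid.Sum +-0-commutativeMonoid
  using (∑-distrib-+; sum-cong-≗; sum-replicate-zero) renaming (sum to ∑)

sum-map-tabulate : ∀ {m n} (f : Fin n → ℕ) (g : Fin m → Fin n) →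
                   sum (map f (tabulate g)) ≡ ∑ (f ∘ g)
sum-map-tabulate {zero}  f g = refl
sum-map-tabulate {suc m} f g = cong (f (g zero) +_) (sum-map-tabulate f (g ∘ suc))

sum-allFin : ∀ {n} (f : Fin n → ℕ) → sum (map f (allFin n)) ≡ ∑ f
sum-allFin f = sum-map-tabulate f id

∑-≤1 : ∀ {n} (f : Fin n → ℕ) → (∀ v → f v ≤ 1) → ∑ f ≤ n
∑-≤1 {zero}  f f≤1 = z≤n
∑-≤1 {suc n} f f≤1 = +-mono-≤ (f≤1 zero) (∑-≤1 (f ∘ suc) (f≤1 ∘ suc))

∑-≤1-strict : ∀ {n} (f : Fin n → ℕ) → (∀ v → f v ≤ 1) → (u : Fin n) → f u ≡ 0 → ∑ f < n
∑-≤1-strict {suc n} f f≤1 zero    fu≡0 rewrite fu≡0 = s≤s (∑-≤1 (f ∘ suc) (f≤1 ∘ suc))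
∑-≤1-strict {suc n} f f≤1 (suc u) fu≡0 =
  +-mono-≤-< (f≤1 zero) (∑-≤1-strict (f ∘ suc) (f≤1 ∘ suc) u fu≡0)

module ListSums {A : Set} where

  ∑-sum-comm : ∀ {n} (g : A → Fin n → ℕ) (xs : List A) →
               ∑ (λ v → sum (map (λ x → g x v) xs)) ≡ sum (map (∑ ∘ g) xs)
  ∑-sum-comm {n} g []       = sum-replicate-zero n
  ∑-sum-comm     g (x ∷ xs) =
    trans (∑-distrib-+ (g x) _) (cong (∑ (g x) +_) (∑-sum-comm g xs))

  sum-map-const : ∀ m (xs : List A) → sum (map (λ _ → m) xs) ≡ length xs * m
  sum-map-const m []       = refl
  sum-map-const m (x ∷ xs) = cong (m +_) (sum-map-const m xs)

  sum-map-≥ : ∀ m (f : A → ℕ) (xs : List A) → (∀ x → m ≤ f x) → length xs * m ≤ sum (map f xs)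
  sum-map-≥ m f []       m≤f = z≤n
  sum-map-≥ m f (x ∷ xs) m≤f = +-mono-≤ (m≤f x) (sum-map-≥ m f xs m≤f)

  sum-map-zero : (f : A → ℕ) {xs : List A} → All (λ x → f x ≡ 0) xs → sum (map f xs) ≡ 0
  sum-map-zero f []           = refl
  sum-map-zero f (fx≡0 ∷ all) rewrite fx≡0 = sum-map-zero f all

  sum-map-∈ : (f : A → ℕ) {x : A} {xs : List A} → x ∈ xs → f x ≤ sum (map f xs)
  sum-map-∈ f           (here refl) = m≤m+n _ _
  sum-map-∈ f {xs = y ∷ _} (there x∈) = ≤-trans (sum-map-∈ f x∈) (m≤n+m _ (f y))

  sum-map-∈₂ : (f : A → ℕ) {x y : A} {xs : List A} → x ∈ xs → y ∈ xs → x ≢ y →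
               f x + f y ≤ sum (map f xs)
  sum-map-∈₂ f (here refl) (here refl) x≢y = ⊥-elim (x≢y refl)
  sum-map-∈₂ f (here refl) (there y∈)  _   = +-monoʳ-≤ (f _) (sum-map-∈ f y∈)
  sum-map-∈₂ f {x} {y} (there x∈) (here refl) _ =
    ≤-trans (≤-reflexive (+-comm (f x) (f y))) (+-monoʳ-≤ (f y) (sum-map-∈ f x∈))
  sum-map-∈₂ f {xs = z ∷ _} (there x∈) (there y∈) x≢y =
    ≤-trans (sum-map-∈₂ f x∈ y∈ x≢y) (m≤n+m _ (f z))

open ListSums

point : ∀ {n} → Fin n → ℕ → Distribution n
point s a v = if does (s ≟ v) then a else 0

point-here : ∀ {n} (s : Fin n) a → point s a s ≡ a
point-here s a rewrite dec-true (s ≟ s) refl = refl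

point-elsewhere : ∀ {n} {s v : Fin n} a → s ≢ v → point s a v ≡ 0
point-elsewhere {s = s} {v} a s≢v rewrite dec-false (s ≟ v) s≢v = refl

∑-point : ∀ {n} (s : Fin n) a → ∑ (point s a) ≡ a
∑-point {suc n} zero    a = trans (cong (a +_) (sum-replicate-zero n)) (+-identityʳ a)
∑-point {suc n} (suc s) a = ∑-point s a

size-+ : ∀ {n} (D E : Distribution n) → size (λ v → D v + E v) ≡ size D + size E
size-+ D E = begin
  size (λ v → D v + E v) ≡⟨ sum-allFin (λ v → D v + E v) ⟩
  ∑ (λ v → D v + E v)    ≡⟨ ∑-distrib-+ D E ⟩
  ∑ D + ∑ E              ≡⟨ cong₂ _+_ (sum-allFin D) (sum-allFin E) ⟨
  size D + size E        ∎
  where open ≡-Reasoning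

size-point : ∀ {n} (s : Fin n) a → size (point s a) ≡ a
size-point s a = trans (sum-allFin (point s a)) (∑-point s a)

module Neighbourhoods {n : ℕ} (G : Graph n) where

  adjacent-sym : ∀ {u v} → Adjacent G u v → Adjacent G v u
  adjacent-sym {u} {v} u~v = trans (sym G v u) u~v

  adjacent-distinct : ∀ {u v} → Adjacent G u v → u ≢ v
  adjacent-distinct {u} u~u refl with trans (≡.sym u~u) (irrefl G u)
  ... | ()

  Close : Fin n → Fin n → Set
  Close u v = u ≡ v ⊎ Adjacent G u v

  close? : Decidable Close
  close? u v = u ≟ v ⊎-dec adj G u v Bool.≟ true

  close-sym : Symmetric Close
  close-sym (inj₁ refl) = inj₁ refl
  close-sym (inj₂ u~v)  = inj₂ (adjacent-sym u~v)

  Near : Fin n → Fin n → Set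
  Near u v = ∃ λ w → Close u w × Close v w

  near? : Decidable Near
  near? u v = any? (λ w → close? u w ×-dec close? v w)

  near-sym : Symmetric Near
  near-sym (w , u≈w , v≈w) = w , v≈w , u≈w

  near-refl : Reflexive Near
  near-refl {u} = u , inj₁ refl , inj₁ refl

  close𝟙 : Fin n → Fin n → ℕ
  close𝟙 u v = if does (close? u v) then 1 else 0

  close𝟙≤1 : ∀ u v → close𝟙 u v ≤ 1
  close𝟙≤1 u v with does (close? u v)
  ... | true  = ≤-refl
  ... | false = z≤n

  close𝟙-off : ∀ {u v} → ¬ Close u v → close𝟙 u v ≡ 0
  close𝟙-off {u} {v} u≉v rewrite dec-false (close? u v) u≉v = refl

  close𝟙-split : ∀ u v → close𝟙 u v ≡ point u 1 v + (if adj G u v then 1 else 0)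
  close𝟙-split u v with u ≟ v
  ... | yes refl rewrite irrefl G u = refl
  ... | no _ with adj G u v
  ...   | true  = refl
  ...   | false = refl

  ∑-close𝟙 : ∀ u → ∑ (close𝟙 u) ≡ suc (degree G u)
  ∑-close𝟙 u = begin
    ∑ (close𝟙 u)                         ≡⟨ sum-cong-≗ (close𝟙-split u) ⟩
    ∑ (λ v → point u 1 v + adjacent𝟙 v)  ≡⟨ ∑-distrib-+ (point u 1) adjacent𝟙 ⟩
    ∑ (point u 1) + ∑ adjacent𝟙          ≡⟨ cong₂ _+_ (∑-point u 1) (≡.sym (sum-allFin adjacent𝟙)) ⟩
    suc (degree G u)                     ∎
    where
    open ≡-Reasoning
    adjacent𝟙 : Fin n → ℕ
    adjacent𝟙 v = if adj G u v then 1 else 0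

module Pebbling {n : ℕ} (G : Graph n) where
  open Neighbourhoods G

  move : Fin n → Fin n → Distribution n → Distribution n
  move u v D w = (D w ∸ (if does (w ≟ u) then 2 else 0)) + (if does (w ≟ v) then 1 else 0)

  move-legal : ∀ {D u v} → Adjacent G u v → 2 ≤ D u → Move G D (move u v D)
  move-legal {D} {u} {v} u~v 2≤Du = u , v , u~v , 2≤Du , λ w → refl

  move-source : ∀ D u v → D u ∸ 2 ≤ move u v D u
  move-source D u v rewrite dec-true (u ≟ u) refl = m≤m+n _ _

  move-target : ∀ D u v → u ≢ v → suc (D v) ≤ move u v D v
  move-target D u v u≢v rewrite dec-false (v ≟ u) (u≢v ∘ ≡.sym) | dec-true (v ≟ v) refl =
    ≤-reflexive (+-comm 1 (D v))

  move-twice : ∀ {D u v} → 4 ≤ D u → Adjacent G u v →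
               ∃ λ D' → Star (Move G) D D' × 2 + D v ≤ D' v
  move-twice {D} {u} {v} 4≤Du u~v =
    D₂ , (move-legal u~v 2≤Du ◅ move-legal u~v 2≤D₁u ◅ ε) , 2+Dv≤D₂v
    where
    u≢v = adjacent-distinct u~v
    D₁ = move u v D
    D₂ = move u v D₁
    2≤Du : 2 ≤ D u
    2≤Du = ≤-trans (m≤m+n 2 2) 4≤Du
    2≤D₁u : 2 ≤ D₁ u
    2≤D₁u = ≤-trans (∸-monoˡ-≤ 2 4≤Du) (move-source D u v)
    2+Dv≤D₂v : 2 + D v ≤ D₂ v
    2+Dv≤D₂v = ≤-trans (s≤s (move-target D u v u≢v)) (move-target D₁ u v u≢v)

  reachable-now : ∀ {D x} → 1 ≤ D x → Reachable G D x
  reachable-now 1≤Dx = _ , ε , 1≤Dx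

  reachable-after : ∀ {D D' x} → Star (Move G) D D' → Reachable G D' x → Reachable G D x
  reachable-after moves (D'' , moves' , 1≤D''x) = D'' , (moves ◅◅ moves') , 1≤D''x

  reach-close : ∀ {D u x} → 2 ≤ D u → Close u x → Reachable G D x
  reach-close             2≤Du (inj₁ refl) = reachable-now (≤-trans (s≤s z≤n) 2≤Du)
  reach-close {D} {u} {x} 2≤Du (inj₂ u~x)  =
    reachable-after (move-legal u~x 2≤Du ◅ ε)
      (reachable-now (≤-trans (s≤s z≤n) (move-target D u x (adjacent-distinct u~x))))

  reach-near : ∀ {D c x} → 4 ≤ D c → Near c x → Reachable G D x
  reach-near 4≤Dc (w , inj₁ refl , x≈w) = reach-close (≤-trans (m≤m+n 2 2) 4≤Dc) (close-sym x≈w)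
  reach-near 4≤Dc (w , inj₂ c~w  , x≈w) with move-twice 4≤Dc c~w
  ... | D' , moves , 2+Dw≤D'w =
    reachable-after moves (reach-close (≤-trans (m≤m+n 2 _) 2+Dw≤D'w) (close-sym x≈w))

  -- Two pebbles on a together with four on a neighbour b of a reach every vertex
  -- of N[c], for any neighbour c of a: moving two pebbles from b to a leaves four on a.
  reach-via : ∀ {D a b c z} → 2 ≤ D a → 4 ≤ D b → Adjacent G b a → Adjacent G a c →
              Close c z → Reachable G D z
  reach-via 2≤Da 4≤Db b~a a~c c≈z with move-twice 4≤Db b~a
  ... | D' , moves , 2+Da≤D'a =
    reachable-after moves
      (reach-near (≤-trans (+-monoʳ-≤ 2 2≤Da) 2+Da≤D'a) (_ , inj₂ a~c , close-sym c≈z))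

size-exchange : ∀ {n} (D P Q : Distribution n) → (∀ v → P v ≤ D v) →
                size (λ v → D v ∸ P v + Q v) + size P ≡ size D + size Q
size-exchange {n} D P Q P≤D = begin
  size D' + size P         ≡⟨ size-+ D' P ⟨
  size (λ v → D' v + P v)  ≡⟨ cong sum (map-cong exchange (allFin n)) ⟩
  size (λ v → D v + Q v)   ≡⟨ size-+ D Q ⟩
  size D + size Q          ∎
  where
  open ≡-Reasoning
  D' : Distribution n
  D' v = D v ∸ P v + Q v
  exchange : ∀ v → D' v + P v ≡ D v + Q v
  exchange v = begin
    D v ∸ P v + Q v + P v    ≡⟨ +-assoc (D v ∸ P v) (Q v) (P v) ⟩
    D v ∸ P v + (Q v + P v)  ≡⟨ cong (D v ∸ P v +_) (+-comm (Q v) (P v)) ⟩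
    D v ∸ P v + (P v + Q v)  ≡⟨ +-assoc (D v ∸ P v) (P v) (Q v) ⟨
    D v ∸ P v + P v + Q v    ≡⟨ cong (_+ Q v) (m∸n+n≡m (P≤D v)) ⟩
    D v + Q v                ∎

crossing-edge : ∀ {A B : Set} {_~_ : A → A → Set} (f : A → B) → DecidableEquality B →
                ∀ {u v} → Star _~_ u v → f u ≢ f v → ∃₂ λ a b → a ~ b × f a ≢ f b
crossing-edge f _≟B_ ε fu≢fv = ⊥-elim (fu≢fv refl)
crossing-edge f _≟B_ {u} (_◅_ {j = w} u~w walk) fu≢fv with f u ≟B f w
... | no  fu≢fw = u , w , u~w , fu≢fw
... | yes fu≡fw = crossing-edge f _≟B_ walk (fu≢fv ∘ trans fu≡fw)

module Packing {A : Set} {R : A → A → Set}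
               (R? : Decidable R) (R-sym : Symmetric R) (R-refl : Reflexive R) where

  Independent : List A → Set
  Independent = AllPairs (λ s t → ¬ R s t)

  greedy : (xs : List A) →
           Σ (List A) λ S → Independent S × (∀ {x} → x ∈ xs → Any (λ s → R s x) S)
  greedy [] = [] , [] , λ ()
  greedy (x ∷ xs) with greedy xs
  ... | S , independent , dominated with Any.any? (λ s → R? s x) S
  ...   | yes x-dominated =
    S , independent , λ { (here refl) → x-dominated ; (there y∈xs) → dominated y∈xs }
  ...   | no x-free =
    x ∷ S , All.map (_∘ R-sym) (¬Any⇒All¬ S x-free) ∷ independent ,
    λ { (here refl) → here R-refl ; (there y∈xs) → there (dominated y∈xs) }

  independent-unique : ∀ {S s t} → Independent S → s ∈ S → t ∈ S → R s t → s ≡ t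
  independent-unique (_ ∷ _)     (here refl) (here refl) _   = refl
  independent-unique (s-free ∷ _) (here refl) (there t∈S) Rst = ⊥-elim (All.lookup s-free t∈S Rst)
  independent-unique (t-free ∷ _) (there s∈S) (here refl) Rst = ⊥-elim (All.lookup t-free s∈S (R-sym Rst))
  independent-unique (_ ∷ indep) (there s∈S) (there t∈S) Rst = independent-unique indep s∈S t∈S Rst

beats-bound : ∀ {d L m n} → d < L * 4 → L * suc m ≤ n → d * suc m < 4 * n
beats-bound {d} {L} {m} {n} d<4L L[m+1]≤n = begin-strict
  d * suc m          <⟨ *-monoˡ-< (suc m) d<4L ⟩
  L * 4 * suc m      ≡⟨ cong (_* suc m) (*-comm L 4) ⟩
  4 * L * suc m      ≡⟨ *-assoc 4 L (suc m) ⟩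
  4 * (L * suc m)    ≤⟨ *-monoʳ-≤ 4 L[m+1]≤n ⟩
  4 * n              ∎
  where open ≤-Reasoning

beats-bound-strict : ∀ {d L m n} → d ≡ L * 4 → L * suc m < n → d * suc m < 4 * n
beats-bound-strict {d} {L} {m} {n} refl L[m+1]<n = begin-strict
  L * 4 * suc m      ≡⟨ cong (_* suc m) (*-comm L 4) ⟩
  4 * L * suc m      ≡⟨ *-assoc 4 L (suc m) ⟩
  4 * (L * suc m)    <⟨ *-monoʳ-< 4 L[m+1]<n ⟩
  4 * n              ∎
  where open ≤-Reasoning

module Construction {n : ℕ} (G : Graph n) (δ : ℕ) (δ≤deg : ∀ v → δ ≤ degree G v)
                    (connected : Connected G) where
  open Neighbourhoods G
  open Pebbling G
  open Packing near? near-sym near-refl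

  S : List (Fin n)
  S = proj₁ (greedy (allFin n))

  S-independent : Independent S
  S-independent = proj₁ (proj₂ (greedy (allFin n)))

  S-dominating : ∀ v → Any (λ s → Near s v) S
  S-dominating v = proj₂ (proj₂ (greedy (allFin n))) (∈-allFin v)

  coverage : Fin n → ℕ
  coverage v = sum (map (λ s → close𝟙 s v) S)

  coverage≤1 : ∀ v {T} → Independent T → sum (map (λ s → close𝟙 s v) T) ≤ 1
  coverage≤1 v []                         = z≤n
  coverage≤1 v {s ∷ T} (s-free ∷ T-indep) with close? s v
  ... | no  s≉v =
    ≤-trans (≤-reflexive (cong (_+ _) (close𝟙-off s≉v))) (coverage≤1 v {T} T-indep)
  ... | yes s≈v =
    +-mono-≤ (close𝟙≤1 s v) (≤-reflexive (sum-map-zero (λ t → close𝟙 t v) others-off))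
    where
    others-off : All (λ t → close𝟙 t v ≡ 0) T
    others-off = All.map (λ ¬near → close𝟙-off (λ t≈v → ¬near (v , s≈v , t≈v))) s-free

  packing-bound : length S * suc δ ≤ ∑ coverage
  packing-bound = begin
    length S * suc δ          ≤⟨ sum-map-≥ (suc δ) (∑ ∘ close𝟙) S |N[s]|≥δ+1 ⟩
    sum (map (∑ ∘ close𝟙) S)  ≡⟨ ∑-sum-comm close𝟙 S ⟨
    ∑ coverage                ∎
    where
    open ≤-Reasoning
    |N[s]|≥δ+1 : ∀ s → suc δ ≤ ∑ (close𝟙 s)
    |N[s]|≥δ+1 s = ≤-trans (s≤s (δ≤deg s)) (≤-reflexive (≡.sym (∑-close𝟙 s)))

  S-bound : length S * suc δ ≤ n
  S-bound = ≤-trans packing-bound (∑-≤1 coverage (λ v → coverage≤1 v S-independent))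

  S-bound-strict : ∀ u → ¬ Any (λ s → Close s u) S → length S * suc δ < n
  S-bound-strict u u-uncovered = ≤-<-trans packing-bound
    (∑-≤1-strict coverage (λ v → coverage≤1 v S-independent) u
      (sum-map-zero (λ s → close𝟙 s u) (All.map close𝟙-off (¬Any⇒All¬ S u-uncovered))))

  pile : Distribution n
  pile v = sum (map (λ s → point s 4 v) S)

  size-pile : size pile ≡ length S * 4
  size-pile = begin
    size pile                          ≡⟨ sum-allFin pile ⟩
    ∑ pile                             ≡⟨ ∑-sum-comm (λ s → point s 4) S ⟩
    sum (map (λ s → ∑ (point s 4)) S)  ≡⟨ cong sum (map-cong (λ s → ∑-point s 4) S) ⟩
    sum (map (λ _ → 4) S)              ≡⟨ sum-map-const 4 S ⟩
    length S * 4                       ∎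
    where open ≡-Reasoning

  pile≥4 : ∀ {s} → s ∈ S → 4 ≤ pile s
  pile≥4 {s} s∈S = subst (_≤ pile s) (point-here s 4) (sum-map-∈ (λ t → point t 4 s) s∈S)

  pile-solvable : Solvable G pile
  pile-solvable x = let s , s∈S , s-near-x = find (S-dominating x) in
                    reach-near (pile≥4 s∈S) s-near-x

  module Covered (covered : ∀ v → Any (λ s → Close s v) S) where

    centre : Fin n → Fin n
    centre v = proj₁ (find (covered v))

    centre∈S : ∀ v → centre v ∈ S
    centre∈S v = proj₁ (proj₂ (find (covered v)))

    centre-close : ∀ v → Close (centre v) v
    centre-close v = proj₂ (proj₂ (find (covered v)))

    -- Along an edge ab between different centres, each centre is a neighbour of its
    -- endpoint: were centre a = a, then b would lie in N[centre a] and N[centre b].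
    centre-adjacent : ∀ {a b} → Adjacent G a b → centre a ≢ centre b → Adjacent G (centre a) a
    centre-adjacent {a} {b} a~b ca≢cb with centre-close a
    ... | inj₂ ca~a = ca~a
    ... | inj₁ ca≡a = ⊥-elim (ca≢cb (independent-unique S-independent (centre∈S a) (centre∈S b)
                        (b , inj₂ (subst (λ c → Adjacent G c b) (≡.sym ca≡a) a~b) , centre-close b)))

    single-centre : ∀ s → (∀ z → centre z ≡ s) → Solvable G (point s 2)
    single-centre s centre≡s z =
      reach-close (≤-reflexive (≡.sym (point-here s 2)))
                  (subst (λ c → Close c z) (centre≡s z) (centre-close z))

    -- An edge ab with centres c₁ = centre a ≠ c₂ = centre b gives the path c₁ a b c₂.
    -- Replacing the pebbles on c₁ and c₂ by two on a and four on b saves two pebbles.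
    module TwoCentres {a b : Fin n} (a~b : Adjacent G a b) (c₁≢c₂ : centre a ≢ centre b) where

      c₁ c₂ : Fin n
      c₁ = centre a
      c₂ = centre b

      c₁~a : Adjacent G c₁ a
      c₁~a = centre-adjacent a~b c₁≢c₂

      c₂~b : Adjacent G c₂ b
      c₂~b = centre-adjacent (adjacent-sym a~b) (c₁≢c₂ ∘ ≡.sym)

      removed added shifted : Distribution n
      removed v = point c₁ 4 v + point c₂ 4 v
      added   v = point a 2 v + point b 4 v
      shifted v = pile v ∸ removed v + added v

      removed≤pile : ∀ v → removed v ≤ pile v
      removed≤pile v = sum-map-∈₂ (λ s → point s 4 v) (centre∈S a) (centre∈S b) c₁≢c₂

      size-removed : size removed ≡ 8
      size-removed = trans (size-+ (point c₁ 4) (point c₂ 4))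
                           (cong₂ _+_ (size-point c₁ 4) (size-point c₂ 4))

      size-added : size added ≡ 6
      size-added = trans (size-+ (point a 2) (point b 4))
                         (cong₂ _+_ (size-point a 2) (size-point b 4))

      size-shifted : size shifted < length S * 4
      size-shifted = ≤-trans (m<m+n (size shifted) {2} (s≤s z≤n)) (≤-reflexive shifted+2≡4|S|)
        where
        open ≡-Reasoning
        shifted+2≡4|S| : size shifted + 2 ≡ length S * 4
        shifted+2≡4|S| = +-cancelʳ-≡ 6 (size shifted + 2) (length S * 4) (begin
          size shifted + 2 + 6         ≡⟨ +-assoc (size shifted) 2 6 ⟩
          size shifted + 8             ≡⟨ cong (size shifted +_) size-removed ⟨
          size shifted + size removed  ≡⟨ size-exchange pile removed added removed≤pile ⟩
          size pile + size added       ≡⟨ cong₂ _+_ size-pile size-added ⟩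
          length S * 4 + 6             ∎)

      2≤shifted-a : 2 ≤ shifted a
      2≤shifted-a = ≤-trans (≤-reflexive (≡.sym (point-here a 2)))
                            (≤-trans (m≤m+n _ (point b 4 a)) (m≤n+m (added a) (pile a ∸ removed a)))

      4≤shifted-b : 4 ≤ shifted b
      4≤shifted-b = ≤-trans (≤-reflexive (≡.sym (point-here b 4)))
                            (≤-trans (m≤n+m _ (point a 2 b)) (m≤n+m (added b) (pile b ∸ removed b)))

      untouched : ∀ {c} → c₁ ≢ c → c₂ ≢ c → pile c ≤ shifted c
      untouched {c} c₁≢c c₂≢c =
        ≤-trans (≤-reflexive (cong (pile c ∸_) (≡.sym removed≡0))) (m≤m+n _ (added c))
        where
        removed≡0 : removed c ≡ 0
        removed≡0 = cong₂ _+_ (point-elsewhere 4 c₁≢c) (point-elsewhere 4 c₂≢c)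

      -- Vertices with centre c₁ are reached through a, those with centre c₂ from b,
      -- and all others from their centre, which kept its four pebbles.
      shifted-solvable : Solvable G shifted
      shifted-solvable z with c₁ ≟ centre z | c₂ ≟ centre z
      ... | yes c₁≡cz | _ =
        reach-via 2≤shifted-a 4≤shifted-b (adjacent-sym a~b) (adjacent-sym c₁~a)
                  (subst (λ c → Close c z) (≡.sym c₁≡cz) (centre-close z))
      ... | no _ | yes c₂≡cz =
        reach-near 4≤shifted-b
          (c₂ , inj₂ (adjacent-sym c₂~b) ,
                close-sym (subst (λ c → Close c z) (≡.sym c₂≡cz) (centre-close z)))
      ... | no c₁≢cz | no c₂≢cz =
        reach-near (≤-trans (pile≥4 (centre∈S z)) (untouched c₁≢cz c₂≢cz))
                   (z , centre-close z , inj₁ refl)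

    -- In the covered case some solvable distribution has fewer than 4|S| pebbles:
    -- either all vertices share one centre, or a walk between vertices with different
    -- centres crosses an edge ab with centre a ≠ centre b.
    covered-solution : Fin n → ∃ λ D → Solvable G D × size D < length S * 4
    covered-solution v₀ with all? (λ z → centre z ≟ centre v₀)
    ... | yes centre≡ = point (centre v₀) 2 , single-centre (centre v₀) centre≡ , 2<4|S|
      where
      open ≤-Reasoning
      2<4|S| : size (point (centre v₀) 2) < length S * 4
      2<4|S| = begin-strict
        size (point (centre v₀) 2)  ≡⟨ size-point (centre v₀) 2 ⟩
        2                           <⟨ m<m+n 2 (s≤s z≤n) ⟩
        4                           ≤⟨ sum-map-∈ (λ _ → 4) (centre∈S v₀) ⟩
        sum (map (λ _ → 4) S)       ≡⟨ sum-map-const 4 S ⟩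
        length S * 4                ∎
    ... | no ¬centre≡ with ¬∀⟶∃¬ n _ (λ z → centre z ≟ centre v₀) ¬centre≡
    ...   | z , cz≢cv₀ with crossing-edge centre _≟_ (connected v₀ z) (cz≢cv₀ ∘ ≡.sym)
    ...     | a , b , a~b , ca≢cb = shifted , shifted-solvable , size-shifted
      where open TwoCentres a~b ca≢cb

  cheap-solvable : Fin n → ∃ λ D → Solvable G D × size D * suc δ < 4 * n
  cheap-solvable v₀ with all? (λ v → Any.any? (λ s → close? s v) S)
  ... | yes covered =
    let D , D-solvable , D<4|S| = Covered.covered-solution covered v₀ in
    D , D-solvable , beats-bound {L = length S} D<4|S| S-bound
  ... | no ¬covered =
    let u , u-uncovered = ¬∀⟶∃¬ n _ (λ v → Any.any? (λ s → close? s v) S) ¬covered in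
    pile , pile-solvable , beats-bound-strict {L = length S} size-pile (S-bound-strict u u-uncovered)

claim7 : (n : ℕ) (G : Graph n) (δ k : ℕ) → Connected G → MinDegree G δ →
         IsOptimalPebblingNumber G k → k * suc δ ≢ 4 * n
claim7 n G δ k connected (δ≤deg , v₀ , _) (_ , k-minimal) k[δ+1]≡4n =
  let D , D-solvable , D-cheap = Construction.cheap-solvable G δ δ≤deg connected v₀ in
  <-irrefl k[δ+1]≡4n (≤-<-trans (*-monoˡ-≤ (suc δ) (k-minimal D D-solvable)) D-cheap)
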